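{- Let $H=(V,E)$ be a finite hypergraph and let $\mathcal{F}=(V',F)$ with $V'\subseteq V$, $F\subseteq E$ be a hyperforest contained in $H$. Then $\mathcal{F}$ has at most $|V|-1$ hyperedges, i.e. $|F|\le |V|-1$.
   Context: A hypergraph $H=(V,E)$ has a finite vertex set $V$ and a set $E$ of nonempty subsets of $V$ (hyperedges). For a hypergraph $(V',E')$ and $X\subseteq V'$, $\Gamma(X)$ denotes the set of edges $e\in E'$ with $e\cap X\neq\emptyset$. A hypergraph $(V',E')$ is a hypercircuit if $|V'|=|E'|$ and $|\Gamma(X)|\ge |X|+1$ for every nonempty proper subset $X\subsetneq V'$. A hypergraph is a hyperforest if it contains no sub-hypergraph that is a hypercircuit. -}

module Defs where

open import Data.Nat using (ℕ; _≤_; _+_; _∸_; suc)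
open import Data.Bool using (Bool; _∧_)
open import Data.Fin using (Fin)
open import Data.Fin.Subset using (Subset; _∈_; _⊆_; _⊂_; _∩_; ∣_∣; Nonempty)
open import Data.Fin.Subset.Properties using (nonempty?)
open import Data.Vec using (tabulate; lookup)
open import Data.Product using (_×_)
open import Function.Definitions using (Injective)
open import Relation.Binary.PropositionalEquality using (_≡_)
open import Relation.Nullary using (¬_)
open import Relation.Nullary.Decidable using (⌊_⌋)

-- A finite hypergraph H = (V, E): V = Fin n, and the edge set E is given by
-- an injective family of nonempty vertex subsets indexed by Fin m
-- (injectivity: E is a *set* of hyperedges, so |E| = m).
record Hypergraph : Set where
  field
    n        : ℕ
    m        : ℕ
    edge     : Fin m → Subset n
    edge-inj : Injective _≡_ _≡_ edge
    edge-ne  : ∀ e → Nonempty (edge e)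
open Hypergraph public

IsSubHypergraph : (H : Hypergraph) → Subset (n H) → Subset (m H) → Set
IsSubHypergraph H W D = ∀ e → e ∈ D → edge H e ⊆ W

Γ : (H : Hypergraph) → Subset (m H) → Subset (n H) → Subset (m H)
Γ H D X = tabulate (λ e → lookup D e ∧ ⌊ nonempty? (edge H e ∩ X) ⌋)

-- Hypercircuits are taken to be nonempty
-- (W nonempty); otherwise the empty hypergraph would be a hypercircuit.
IsHypercircuit : (H : Hypergraph) → Subset (n H) → Subset (m H) → Set
IsHypercircuit H W D =
  Nonempty W × ∣ W ∣ ≡ ∣ D ∣ ×
  (∀ (X : Subset (n H)) → Nonempty X → X ⊂ W → suc ∣ X ∣ ≤ ∣ Γ H D X ∣)

IsHyperforest : (H : Hypergraph) → Subset (n H) → Subset (m H) → Set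
IsHyperforest H V' F =
  ∀ (W : Subset (n H)) (D : Subset (m H)) →
    W ⊆ V' → D ⊆ F → IsSubHypergraph H W D → ¬ IsHypercircuit H W D

-- Call a vertex set W ⊆ V' sparse if fewer than |W| edges of F lie inside W.
-- In a hyperforest every nonempty W ⊆ V' is sparse: take a minimal W that is
-- not, and keep |W| of the edges inside it.  For a nonempty proper X ⊂ W the
-- complement W ∖ X is sparse by minimality, and every kept edge either meets X
-- or lies inside W ∖ X, so |Γ(X)| > |X|: the kept edges form a hypercircuit on
-- W.  Applied to W = V', this gives |F| < |V'| ≤ |V|.
module Submission where

open import Defs
open import Data.Nat using (ℕ; zero; suc; _≤_; _<_; _∸_; _+_; z≤n; s≤s; _<?_)
open import Data.Nat.Properties
open import Data.Nat.Induction using (<-wellFounded)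
open import Data.Bool using (true; false; _∧_)
open import Data.Bool.Properties using (T-≡)
open import Data.Fin using (Fin)
open import Data.Fin.Subset
  using (Subset; ∣_∣; _∈_; _⊆_; _⊂_; _∪_; _∩_; _─_; Nonempty; ⊥; inside; outside)
open import Data.Fin.Subset.Properties
open import Data.Vec using ([]; _∷_; tabulate; lookup; here)
open import Data.Vec.Properties using (lookup∘tabulate; []=⇒lookup; lookup⇒[]=)
open import Data.Product using (Σ; _×_; _,_; proj₁)
open import Data.Sum using (inj₁; inj₂)
open import Data.Empty using (⊥-elim)
open import Function.Bundles using (Equivalence)
open import Induction.WellFounded using (WellFounded; module Subrelation; module All)
open import Level using (0ℓ)
open import Relation.Binary.Construct.On as On using ()
open import Relation.Binary.PropositionalEquality using (_≡_; refl; sym; trans; cong; cong₂)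
open import Relation.Nullary using (Dec; yes; no)
open import Relation.Nullary.Decidable using (⌊_⌋; fromWitness)

-- Γ H D X unfolds to filter (λ e → nonempty? (edge H e ∩ X)) D.
module _ {k : ℕ} where

  filter : {P : Fin k → Set} → (∀ x → Dec (P x)) → Subset k → Subset k
  filter P? D = tabulate λ x → lookup D x ∧ ⌊ P? x ⌋

  module _ {P : Fin k → Set} (P? : ∀ x → Dec (P x)) {D : Subset k} {x : Fin k} where

    x∈filter⁺ : x ∈ D → P x → x ∈ filter P? D
    x∈filter⁺ x∈D px = lookup⇒[]= x (filter P? D)
      (trans (lookup∘tabulate _ x) (cong₂ _∧_ ([]=⇒lookup x∈D) (Equivalence.to T-≡ (fromWitness px))))

    x∈filter⁻ : x ∈ filter P? D → x ∈ D × P x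
    x∈filter⁻ x∈ with lookup D x in eq | P? x
                    | trans (sym (lookup∘tabulate _ x)) ([]=⇒lookup x∈)
    ... | true  | yes px | _ = lookup⇒[]= x D eq , px
    ... | true  | no _   | ()
    ... | false | _      | ()

∣p∪q∣≤∣p∣+∣q∣ : ∀ {k} (p q : Subset k) → ∣ p ∪ q ∣ ≤ ∣ p ∣ + ∣ q ∣
∣p∪q∣≤∣p∣+∣q∣ []            []            = z≤n
∣p∪q∣≤∣p∣+∣q∣ (inside  ∷ p) (inside  ∷ q) =
  s≤s (≤-trans (m≤n⇒m≤1+n (∣p∪q∣≤∣p∣+∣q∣ p q)) (≤-reflexive (sym (+-suc ∣ p ∣ ∣ q ∣))))
∣p∪q∣≤∣p∣+∣q∣ (inside  ∷ p) (outside ∷ q) = s≤s (∣p∪q∣≤∣p∣+∣q∣ p q)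
∣p∪q∣≤∣p∣+∣q∣ (outside ∷ p) (inside  ∷ q) =
  ≤-trans (s≤s (∣p∪q∣≤∣p∣+∣q∣ p q)) (≤-reflexive (sym (+-suc ∣ p ∣ ∣ q ∣)))
∣p∪q∣≤∣p∣+∣q∣ (outside ∷ p) (outside ∷ q) = ∣p∪q∣≤∣p∣+∣q∣ p q

q⊆p⇒∣q∣+∣p─q∣≡∣p∣ : ∀ {k} (p q : Subset k) → q ⊆ p → ∣ q ∣ + ∣ p ─ q ∣ ≡ ∣ p ∣
q⊆p⇒∣q∣+∣p─q∣≡∣p∣ []            []            _   = refl
q⊆p⇒∣q∣+∣p─q∣≡∣p∣ (inside  ∷ p) (inside  ∷ q) q⊆p =
  cong suc (q⊆p⇒∣q∣+∣p─q∣≡∣p∣ p q (drop-∷-⊆ q⊆p))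
q⊆p⇒∣q∣+∣p─q∣≡∣p∣ (outside ∷ p) (inside  ∷ q) q⊆p with () ← q⊆p here
q⊆p⇒∣q∣+∣p─q∣≡∣p∣ (inside  ∷ p) (outside ∷ q) q⊆p =
  trans (+-suc ∣ q ∣ ∣ p ─ q ∣) (cong suc (q⊆p⇒∣q∣+∣p─q∣≡∣p∣ p q (drop-∷-⊆ q⊆p)))
q⊆p⇒∣q∣+∣p─q∣≡∣p∣ (outside ∷ p) (outside ∷ q) q⊆p =
  q⊆p⇒∣q∣+∣p─q∣≡∣p∣ p q (drop-∷-⊆ q⊆p)

subsetOfSize : ∀ {k} j (p : Subset k) → j ≤ ∣ p ∣ → Σ (Subset k) λ q → q ⊆ p × ∣ q ∣ ≡ j
subsetOfSize {k} zero p _ = ⊥ , ⊥⊆ , ∣⊥∣≡0 k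
subsetOfSize (suc j) (inside ∷ p) (s≤s j≤∣p∣)
  with q , q⊆p , ∣q∣≡j ← subsetOfSize j p j≤∣p∣
  = inside ∷ q , s⊆s q⊆p , cong suc ∣q∣≡j
subsetOfSize (suc j) (outside ∷ p) j<∣p∣
  with q , q⊆p , ∣q∣≡j ← subsetOfSize (suc j) p j<∣p∣
  = outside ∷ q , out⊆ q⊆p , ∣q∣≡j

⊂-wellFounded : ∀ {k} → WellFounded (_⊂_ {k})
⊂-wellFounded = Subrelation.wellFounded p⊂q⇒∣p∣<∣q∣ (On.wellFounded ∣_∣ <-wellFounded)

module _ (H : Hypergraph) where

  edgesWithin : Subset (m H) → Subset (n H) → Subset (m H)
  edgesWithin F W = filter (λ e → edge H e ⊆? W) F

  module _ (F : Subset (m H)) (W : Subset (n H)) where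

    edgesWithin⊆ : edgesWithin F W ⊆ F
    edgesWithin⊆ e∈ with e∈F , _ ← x∈filter⁻ (λ e → edge H e ⊆? W) {F} e∈ = e∈F

    edgesWithin-sub : IsSubHypergraph H W (edgesWithin F W)
    edgesWithin-sub e e∈ with _ , e⊆W ← x∈filter⁻ (λ e → edge H e ⊆? W) {F} e∈ = e⊆W

  Γ∪edgesWithin─-cover : ∀ {F D W} X → D ⊆ edgesWithin F W →
                         D ⊆ Γ H D X ∪ edgesWithin F (W ─ X)
  Γ∪edgesWithin─-cover {F} {D} {W} X D⊆ {e} e∈D with nonempty? (edge H e ∩ X)
  ... | yes meets = x∈p∪q⁺ (inj₁ (x∈filter⁺ (λ e → nonempty? (edge H e ∩ X)) e∈D meets))
  ... | no misses = x∈p∪q⁺ (inj₂ (x∈filter⁺ (λ e → edge H e ⊆? W ─ X) (edgesWithin⊆ F W (D⊆ e∈D)) e⊆W─X))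
    where
    e⊆W─X : edge H e ⊆ W ─ X
    e⊆W─X x∈e = x∈p∧x∉q⇒x∈p─q (edgesWithin-sub F W e (D⊆ e∈D) x∈e)
                               (λ x∈X → misses (_ , x∈p∩q⁺ (x∈e , x∈X)))

  Γ-expands : ∀ {F D W X} → D ⊆ edgesWithin F W → ∣ W ∣ ≡ ∣ D ∣ → X ⊆ W →
              ∣ edgesWithin F (W ─ X) ∣ < ∣ W ─ X ∣ → suc ∣ X ∣ ≤ ∣ Γ H D X ∣
  Γ-expands {F} {D} {W} {X} D⊆ ∣W∣≡∣D∣ X⊆W sparse =
    +-cancelʳ-≤ (∣ E─ ∣) (suc ∣ X ∣) (∣ Γ H D X ∣) (begin
      suc ∣ X ∣ + ∣ E─ ∣          ≡⟨ sym (+-suc ∣ X ∣ ∣ E─ ∣) ⟩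
      ∣ X ∣ + suc ∣ E─ ∣          ≤⟨ +-monoʳ-≤ ∣ X ∣ sparse ⟩
      ∣ X ∣ + ∣ W ─ X ∣           ≡⟨ q⊆p⇒∣q∣+∣p─q∣≡∣p∣ W X X⊆W ⟩
      ∣ W ∣                       ≡⟨ ∣W∣≡∣D∣ ⟩
      ∣ D ∣                       ≤⟨ p⊆q⇒∣p∣≤∣q∣ (Γ∪edgesWithin─-cover {F} {D} {W} X D⊆) ⟩
      ∣ Γ H D X ∪ E─ ∣            ≤⟨ ∣p∪q∣≤∣p∣+∣q∣ (Γ H D X) E─ ⟩
      ∣ Γ H D X ∣ + ∣ E─ ∣        ∎)
    where
    open ≤-Reasoning
    E─ = edgesWithin F (W ─ X)

  tight⇒hypercircuit : ∀ {F W} → Nonempty W → ∣ W ∣ ≤ ∣ edgesWithin F W ∣ →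
    (∀ X → Nonempty X → X ⊂ W → ∣ edgesWithin F X ∣ < ∣ X ∣) →
    Σ (Subset (m H)) λ D → D ⊆ edgesWithin F W × IsHypercircuit H W D
  tight⇒hypercircuit {F} {W} W≢∅ tight sparse
    with D , D⊆ , ∣D∣≡∣W∣ ← subsetOfSize ∣ W ∣ (edgesWithin F W) tight
    = D , D⊆ , W≢∅ , sym ∣D∣≡∣W∣ , expands
    where
    expands : ∀ X → Nonempty X → X ⊂ W → suc ∣ X ∣ ≤ ∣ Γ H D X ∣
    expands X (x , x∈X) (X⊆W , y , y∈W , y∉X) =
      Γ-expands {F} {D} {W} D⊆ (sym ∣D∣≡∣W∣) X⊆W
        (sparse (W ─ X) (y , x∈p∧x∉q⇒x∈p─q y∈W y∉X)
                (p∩q≢∅⇒p─q⊂p W X (x , x∈p∩q⁺ (X⊆W x∈X , x∈X))))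

  hyperforest⇒sparse : ∀ {V' F} → IsHyperforest H V' F →
    ∀ W → Nonempty W → W ⊆ V' → ∣ edgesWithin F W ∣ < ∣ W ∣
  hyperforest⇒sparse {V'} {F} forest =
    All.wfRec ⊂-wellFounded 0ℓ Sparse minimalNonsparse
    where
    Sparse : Subset (n H) → Set
    Sparse W = Nonempty W → W ⊆ V' → ∣ edgesWithin F W ∣ < ∣ W ∣

    minimalNonsparse : ∀ W → (∀ {X} → X ⊂ W → Sparse X) → Sparse W
    minimalNonsparse W sparse⊂ W≢∅ W⊆V' with ∣ edgesWithin F W ∣ <? ∣ W ∣
    ... | yes sparseW = sparseW
    ... | no nonsparse
      with D , D⊆ , circuit ← tight⇒hypercircuit {F} {W} W≢∅ (≮⇒≥ nonsparse)
                                (λ X X≢∅ X⊂W → sparse⊂ X⊂W X≢∅ (⊆-trans (proj₁ X⊂W) W⊆V'))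
      = ⊥-elim (forest W D W⊆V' (⊆-trans D⊆ (edgesWithin⊆ F W))
                        (λ e e∈D → edgesWithin-sub F W e (D⊆ e∈D)) circuit)

theorem5 : (H : Hypergraph) (V' : Subset (n H)) (F : Subset (m H)) →
    IsSubHypergraph H V' F → IsHyperforest H V' F → ∣ F ∣ ≤ n H ∸ 1
theorem5 H V' F sub forest with nonempty? F
... | no F-empty rewrite Empty-unique F-empty | ∣⊥∣≡0 (m H) = z≤n
... | yes (e , e∈F) with x , x∈e ← edge-ne H e = ∸-monoˡ-≤ 1 (begin-strict
      ∣ F ∣                   ≤⟨ p⊆q⇒∣p∣≤∣q∣ F⊆ ⟩
      ∣ edgesWithin H F V' ∣  <⟨ hyperforest⇒sparse H forest V' (x , sub e e∈F x∈e) ⊆-refl ⟩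
      ∣ V' ∣                  ≤⟨ ∣p∣≤n V' ⟩
      n H                     ∎)
  where
  open ≤-Reasoning
  F⊆ : F ⊆ edgesWithin H F V'
  F⊆ e∈F = x∈filter⁺ (λ e → edge H e ⊆? V') e∈F (sub _ e∈F)
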